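{- $\vDash_{\mathsf{PI}}\Box\forall x,y,z\in\mathbb{N}\,((Sxz\wedge Syz)\rightarrow x=y)$.
   Context: PI model: $\mathcal{M}=\langle W,R,D,I\rangle$ with $W$ countably infinite, $R$ a directed partial order, each $D(w)$ non-empty finite, $n$-ary second-order quantifiers at $w$ range over all subsets of $D(w)^n$, $D(w)\subsetneq D(s)$ whenever $R(w,s)$, $w\ne s$, and an injection $\mathbf{a}:\omega\to\bigcup_wD(w)$ with $\#X=\mathbf{a}_{|X|}$ at every world for all $X\subseteq D(s)$, $s\in W$. Kripke semantics: actualist first-order quantifiers over $D(w)$, free variables may denote any object of the model, rigid set variables, $\Box$ over $R$-successors. $\vDash_{\mathsf{PI}}\varphi$: true at every world of every PI model under every assignment. Definitions: $0:=\#\varnothing$; $Sxy:\equiv\Diamond\exists G\exists u[Gu\wedge y=\#G\wedge x=\#(G\setminus\{u\})]$; $S^+(a,b):\equiv\forall X[(\forall x,y(Xx\wedge Sxy\rightarrow Xy)\wedge\forall x(Sax\rightarrow Xx))\rightarrow Xb]$; $S^{+=}(a,b):\equiv S^+(a,b)\vee a=b$; $\mathbb{N}x:\equiv S^{+=}(0,x)\wedge\exists y(y=0)$; $\forall x\in\mathbb{N}\,\varphi$ abbreviates $\forall x(\mathbb{N}x\rightarrow\varphi)$. -}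

module Defs where

open import Data.Nat using (ℕ)
open import Data.List using (List; length)
open import Data.List.Membership.Propositional using (_∈_)
open import Data.List.Relation.Unary.Unique.Propositional using (Unique)
open import Data.Product using (Σ; ∃; _×_; _,_)
open import Data.Sum using (_⊎_)
open import Relation.Binary.PropositionalEquality using (_≡_)
open import Relation.Nullary using (¬_)
open import Function.Bundles using (_↔_)
open import Function.Definitions using (Injective)

-- A (unary) second-order value: a predicate on the objects of the model.
Subset : Set → Set₁
Subset O = O → Set

HasCard : {O : Set} → Subset O → ℕ → Set
HasCard {O} X n =
  Σ (List O) λ l → (length l ≡ n) × Unique l × (∀ o → (X o → o ∈ l) × (o ∈ l → X o))

-- PI models  ⟨W, R, D, I⟩ together with the injection a : ω → ⋃ D(w).
-- O is the collection of all objects of the model; D w o means o ∈ D(w).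
record PIModel : Set₁ where
  field
    W       : Set
    W-count : W ↔ ℕ
    R       : W → W → Set
    R-refl  : ∀ w → R w w
    R-trans : ∀ {u v w} → R u v → R v w → R u w
    R-antisym : ∀ {u v} → R u v → R v u → u ≡ v
    R-directed : ∀ u v → ∃ λ w → R u w × R v w
    O       : Set
    D       : W → O → Set
    D-nonempty : ∀ w → ∃ λ o → D w o
    D-finite   : ∀ w → Σ (List O) λ l → ∀ o → (D w o → o ∈ l) × (o ∈ l → D w o)
    D-strict   : ∀ {w s} → R w s → ¬ (w ≡ s) →
                 (∀ o → D w o → D s o) × (∃ λ o → D s o × ¬ D w o)
    a       : ℕ → O
    a-inj   : Injective _≡_ _≡_ a

module Semantics (M : PIModel) where
  open PIModel M

  -- X ⊆ D(w): X is in the range of (unary) second-order quantifiers at w.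
  _⊆D_ : Subset O → W → Set
  X ⊆D w = ∀ o → X o → D w o

  -- the value of the term #X : a_{|X|}
  IsNum : O → Subset O → Set
  IsNum y X = ∃ λ n → HasCard X n × y ≡ a n

  minus : Subset O → O → Subset O
  minus G u o = G o × ¬ (o ≡ u)

  -- 0 := #∅ ; its value is a_{|∅|} = a_0
  zeroO : O
  zeroO = a 0

  -- S x y at world v :  ◇ ∃G ∃u [G u ∧ y = #G ∧ x = #(G ∖ {u})]
  S : W → O → O → Set₁
  S v x y = ∃ λ v' → R v v' × Σ (Subset O) λ G → G ⊆D v' ×
              ∃ λ u → D v' u × G u × IsNum y G × IsNum x (minus G u)

  S⁺ : W → O → O → Set₁
  S⁺ v b c = (X : Subset O) → X ⊆D v →
              ((∀ x y → D v x → D v y → X x → S v x y → X y) ×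
               (∀ x → D v x → S v b x → X x)) → X c

  S⁺⁼ : W → O → O → Set₁
  S⁺⁼ v b c = S⁺ v b c ⊎ Lift-≡ b c
    where
    open import Level using (Lift)
    Lift-≡ : O → O → Set₁
    Lift-≡ p q = Lift _ (p ≡ q)

  Nat : W → O → Set₁
  Nat v x = S⁺⁼ v zeroO x × ∃ λ y → D v y × y ≡ zeroO

BoxSuccFunctional : (M : PIModel) → PIModel.W M → Set₁
BoxSuccFunctional M w =
  ∀ s → R w s →
  ∀ x y z → D s x → D s y → D s z →
  Nat s x → Nat s y → Nat s z →
  S s x z → S s y z → x ≡ y
  where
  open PIModel M
  open Semantics M

-- The value of #X is a applied to the cardinality of X, and a is injective; so S x z forces
-- x = a(k) and z = a(k+1) where k = |G ∖ {u}| and |G| = k + 1. Hence z determines x.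
module Submission where

open import Defs
open import Data.Nat using (suc; _≤_; z≤n; s≤s)
open import Data.Nat.Properties using (≤-antisym; suc-injective; _≤?_)
open import Data.List using (List; []; _∷_; length)
open import Data.List.Properties using (length-removeAt′)
open import Data.List.Membership.Propositional using (_∈_; _─_)
open import Data.List.Relation.Binary.Subset.Propositional using (_⊆_)
open import Data.List.Relation.Unary.Any using (here; there)
open import Data.List.Relation.Unary.All as All using ()
open import Data.List.Relation.Unary.Unique.Propositional using (Unique)
open import Data.List.Relation.Unary.AllPairs using (_∷_)
open import Data.Product using (∃; _×_; _,_; proj₁; proj₂)
open import Data.Sum using (_⊎_; inj₁; inj₂)
open import Level using (0ℓ)
open import Relation.Nullary using (¬_; yes; no; contradiction)
open import Relation.Nullary.Decidable using (decidable-stable; ¬¬-excluded-middle)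
open import Relation.Nullary.Negation using (¬¬-Monad; ¬¬-map)
open import Relation.Binary.PropositionalEquality using (_≡_; _≢_; refl; sym; trans; cong; subst)

module _ {A : Set} where

  ∈-─⁺ : ∀ {x y} {xs : List A} (y∈xs : y ∈ xs) → x ∈ xs → x ≢ y → x ∈ xs ─ y∈xs
  ∈-─⁺ (here refl)  (here refl)  x≢y = contradiction refl x≢y
  ∈-─⁺ (here refl)  (there x∈xs) _   = x∈xs
  ∈-─⁺ (there _)    (here refl)  _   = here refl
  ∈-─⁺ (there y∈xs) (there x∈xs) x≢y = there (∈-─⁺ y∈xs x∈xs x≢y)

  length-mono-⊆ : ∀ {xs ys : List A} → Unique xs → xs ⊆ ys → length xs ≤ length ys
  length-mono-⊆ {[]}     _     _     = z≤n
  length-mono-⊆ {x ∷ xs} {ys} (x∉xs ∷ xs!) xs⊆ys =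
    subst (suc (length xs) ≤_) (sym (length-removeAt′ ys _))
      (s≤s (length-mono-⊆ xs! λ y∈xs →
        ∈-─⁺ x∈ys (xs⊆ys (there y∈xs)) (λ y≡x → All.lookup x∉xs y∈xs (sym y≡x))))
    where x∈ys = xs⊆ys (here refl)

  -- ≤ on ℕ is decidable, hence stable, so the inclusion need only hold up to double negation;
  -- this avoids assuming decidable equality on A.
  length-mono-¬¬⊆ : ∀ {xs ys : List A} → Unique xs → (∀ {x} → x ∈ xs → ¬ ¬ x ∈ ys) →
                    length xs ≤ length ys
  length-mono-¬¬⊆ {xs} {ys} xs! xs⊆ys =
    decidable-stable (length xs ≤? length ys)
      (¬¬-map (λ all∈ys → length-mono-⊆ xs! (All.lookup all∈ys))
              (All.sequenceM 0ℓ ¬¬-Monad (All.tabulate xs⊆ys)))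

  HasCard-mono : ∀ {X Y : Subset A} {m n} → HasCard X m → HasCard Y n →
                 (∀ {o} → X o → ¬ ¬ Y o) → m ≤ n
  HasCard-mono (xs , refl , xs! , X↔xs) (ys , refl , _ , Y↔ys) X⊆Y =
    length-mono-¬¬⊆ xs! λ {o} o∈xs → ¬¬-map (proj₁ (Y↔ys o)) (X⊆Y (proj₂ (X↔xs o) o∈xs))

  HasCard-insert : ∀ {X : Subset A} {u k} → HasCard X k → ¬ X u →
                   HasCard (λ o → o ≡ u ⊎ X o) (suc k)
  HasCard-insert {X} {u} (xs , refl , xs! , X↔xs) u∉X =
    u ∷ xs , refl , All.tabulate u≢ ∷ xs! , λ o → to o , from o
    where
    u≢ : ∀ {o} → o ∈ xs → u ≢ o
    u≢ o∈xs refl = u∉X (proj₂ (X↔xs u) o∈xs)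
    to : ∀ o → o ≡ u ⊎ X o → o ∈ u ∷ xs
    to o (inj₁ refl) = here refl
    to o (inj₂ Xo)   = there (proj₁ (X↔xs o) Xo)
    from : ∀ o → o ∈ u ∷ xs → o ≡ u ⊎ X o
    from o (here o≡u)   = inj₁ o≡u
    from o (there o∈xs) = inj₂ (proj₂ (X↔xs o) o∈xs)

  HasCard-remove : ∀ {G : Subset A} {u n k} → HasCard G n → G u →
                   HasCard (λ o → G o × o ≢ u) k → n ≡ suc k
  HasCard-remove {G} {u} |G|≡n Gu |G∖u|≡k = ≤-antisym (HasCard-mono |G|≡n |u+G∖u| split)
                                                      (HasCard-mono |u+G∖u| |G|≡n merge)
    where
    |u+G∖u| = HasCard-insert |G∖u|≡k (λ (_ , u≢u) → u≢u refl)
    split : ∀ {o} → G o → ¬ ¬ (o ≡ u ⊎ (G o × o ≢ u))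
    split {o} Go = ¬¬-map (λ { (yes o≡u) → inj₁ o≡u ; (no o≢u) → inj₂ (Go , o≢u) })
                          ¬¬-excluded-middle
    merge : ∀ {o} → o ≡ u ⊎ (G o × o ≢ u) → ¬ ¬ G o
    merge (inj₁ refl)     = contradiction Gu
    merge (inj₂ (Go , _)) = contradiction Go

module _ (M : PIModel) where
  open PIModel M
  open Semantics M

  S-consecutive : ∀ {v x z} → S v x z → ∃ λ k → x ≡ a k × z ≡ a (suc k)
  S-consecutive (_ , _ , G , _ , u , _ , Gu , (n , |G|≡n , z≡aₙ) , (k , |G∖u|≡k , x≡aₖ)) =
    k , x≡aₖ , trans z≡aₙ (cong a (HasCard-remove |G|≡n Gu |G∖u|≡k))

  S-functionalˡ : ∀ {v x y z} → S v x z → S v y z → x ≡ y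
  S-functionalˡ Sxz Syz with S-consecutive Sxz | S-consecutive Syz
  ... | k , x≡aₖ , z≡aₖ₊₁ | l , y≡aₗ , z≡aₗ₊₁ =
    trans x≡aₖ (trans (cong a k≡l) (sym y≡aₗ))
    where k≡l = suc-injective (a-inj (trans (sym z≡aₖ₊₁) z≡aₗ₊₁))

lemma17 : (M : PIModel) (w : PIModel.W M) → BoxSuccFunctional M w
lemma17 M _ _ _ _ _ _ _ _ _ _ _ _ = S-functionalˡ M
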